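{- Let $G$ be a graph, and suppose Algorithm Find_Generalized_Handle, run on $G$, returns a pair $(H,J)$. Then the co-handle $J$ is a maximal interesting set in $\overline{G}$.
   Context: All graphs are finite and simple; $\overline{G}$ is the complement of $G$. For $X\subseteq V$, $N(X)$ is the set of vertices of $V\setminus X$ with a neighbour in $X$, and $C(X)$ is the set of vertices of $V\setminus X$ adjacent to all of $X$; for an edge $e=xy$, $N(e)=N(\{x,y\})$. A vertex $v$ misses an edge $e$ if $v$ is adjacent to neither endpoint of $e$. A non-empty set $T$ is interesting in a graph $F$ if the complement of $F[T]$ is connected and $F[C(T)]$ is not a clique; maximal if not strictly contained in another interesting set. A generalized handle in $G=(V,E)$ is a subset $H\subset V$ containing at least one edge such that some connected component $J\neq H$ of $G\setminus N(H)$ satisfies $N(J)=N(H)$ and every vertex of $N(H)$ is adjacent to at least one endpoint of each edge of $G[H]$; $J$ is then a generalized co-handle of $H$. Algorithm Find_Generalized_Handle: Search for a vertex $v$ and an edge $e$ such that $v$ misses $e$; if none exist, return "no handle" and stop. Set $J:=$ the component of $G\setminus N(e)$ containing $v$, and $H:=V\setminus(J\cup N(J))$. While some vertex $v\in N(H)$ misses some edge $e$ of $G[H]$: set $J:=$ the component of $G\setminus N(e)$ containing $v$ and $H:=V\setminus(J\cup N(J))$. Return $(H,J)$. -}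

module Defs where

open import Level using (0ℓ)
open import Data.Nat using (ℕ)
open import Data.Fin using (Fin)
open import Data.Fin.Subset using (Subset; _∈_)
open import Data.Product using (Σ; ∃; _×_; _,_)
open import Data.Sum using (_⊎_)
open import Relation.Nullary using (¬_; Dec)
open import Relation.Unary using (Pred; _⊆_)
open import Relation.Binary.PropositionalEquality using (_≡_; _≢_)

record Graph (n : ℕ) : Set₁ where
  field
    Adj     : Fin n → Fin n → Set
    adj?    : ∀ x y → Dec (Adj x y)
    sym     : ∀ {x y} → Adj x y → Adj y x
    irrefl  : ∀ {x} → ¬ Adj x x
open Graph public

VSet : ℕ → Set₁
VSet n = Pred (Fin n) 0ℓ

module _ {n : ℕ} where

  compl : Graph n → Graph n
  compl G = record
    { Adj    = λ x y → (x ≢ y) × ¬ Adj G x y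
    ; adj?   = dec
    ; sym    = λ { (x≢y , ¬a) → (λ e → x≢y (symm e)) , (λ a → ¬a (Graph.sym G a)) }
    ; irrefl = λ { (x≢x , _) → x≢x refl' }
    }
    where
    open import Relation.Binary.PropositionalEquality using (refl) renaming (sym to symm)
    open import Data.Fin using (_≟_)
    open import Relation.Nullary using (yes; no)
    refl' : ∀ {x : Fin n} → x ≡ x
    refl' = refl
    dec : ∀ x y → Dec ((x ≢ y) × ¬ Adj G x y)
    dec x y with x ≟ y | adj? G x y
    ... | yes e | _     = no λ { (x≢y , _) → x≢y e }
    ... | no ne | yes a = no λ { (_ , ¬a) → ¬a a }
    ... | no ne | no ¬a = yes (ne , ¬a)

  Nbh : Graph n → VSet n → VSet n
  Nbh G X v = ¬ X v × ∃ λ u → X u × Adj G u v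

  Com : Graph n → VSet n → VSet n
  Com G X v = ¬ X v × (∀ u → X u → Adj G u v)

  pair : Fin n → Fin n → VSet n
  pair x y v = (v ≡ x) ⊎ (v ≡ y)

  NbhE : Graph n → Fin n → Fin n → VSet n
  NbhE G x y = Nbh G (pair x y)

  Misses : Graph n → Fin n → Fin n → Fin n → Set
  Misses G v x y = ¬ Adj G v x × ¬ Adj G v y

  data Reach (G : Graph n) (S : VSet n) (u : Fin n) : Fin n → Set where
    here : S u → Reach G S u u
    step : ∀ {w z} → Reach G S u w → Adj G w z → S z → Reach G S u z

  Minus : VSet n → VSet n
  Minus X v = ¬ X v

  Comp : Graph n → VSet n → Fin n → VSet n
  Comp G X v w = Reach G (Minus X) v w

  ConnectedOn : Graph n → VSet n → Set
  ConnectedOn G T = ∀ u w → T u → T w → Reach G T u w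

  CliqueOn : Graph n → VSet n → Set
  CliqueOn G S = ∀ u w → S u → S w → u ≢ w → Adj G u w

  Interesting : Graph n → VSet n → Set
  Interesting F T =
    (∃ λ t → T t) × ConnectedOn (compl F) T × ¬ CliqueOn F (Com F T)

  MaximalInteresting : Graph n → VSet n → Set
  MaximalInteresting F T =
    Interesting F T ×
    (∀ (T' : Subset n) → Interesting F (_∈ T') → T ⊆ (_∈ T') → (_∈ T') ⊆ T)

  -- Algorithm Find_Generalized_Handle.
  -- A state of the algorithm is determined by the pair (v, e = xy) chosen last:
  --   J := component of G \ N(e) containing v,   H := V \ (J ∪ N(J)).

  CoHandleOf : Graph n → Fin n → Fin n → Fin n → VSet n
  CoHandleOf G v x y = Comp G (NbhE G x y) v

  HandleOf : Graph n → Fin n → Fin n → Fin n → VSet n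
  HandleOf G v x y w =
    ¬ (CoHandleOf G v x y w ⊎ Nbh G (CoHandleOf G v x y) w)

  LoopStep : Graph n → VSet n → Fin n → Fin n → Fin n → Set
  LoopStep G H v' x' y' =
    Nbh G H v' × H x' × H y' × Adj G x' y' × Misses G v' x' y'

  data Reachable (G : Graph n) : Fin n → Fin n → Fin n → Set where
    start : ∀ {v x y} → Adj G x y → Misses G v x y → Reachable G v x y
    next  : ∀ {v x y v' x' y'} → Reachable G v x y →
            LoopStep G (HandleOf G v x y) v' x' y' → Reachable G v' x' y'

  Terminal : Graph n → Fin n → Fin n → Fin n → Set
  Terminal G v x y =
    ¬ (∃ λ v' → ∃ λ x' → ∃ λ y' → LoopStep G (HandleOf G v x y) v' x' y')

  Returns : Graph n → VSet n → VSet n → Set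
  Returns G H J = ∃ λ v → ∃ λ x → ∃ λ y →
    Reachable G v x y × Terminal G v x y ×
    (∀ w → (H w → HandleOf G v x y w) × (HandleOf G v x y w → H w)) ×
    (∀ w → (J w → CoHandleOf G v x y w) × (CoHandleOf G v x y w → J w))

{-# OPTIONS --safe #-}
-- J is the component containing v of G ∖ N(X) for the last edge X = {x , y} chosen
-- by the algorithm. Since x and y lie outside J ∪ N(J), they belong to the common
-- neighbourhood of J in the complement, where they are non-adjacent, so J is
-- interesting; and J induces a connected subgraph of G, the complement of the
-- complement. If T ⊋ J were interesting, a G-path inside T would leave J through a
-- vertex z ∈ N(X) ∩ N(J), hence z ∈ N(H). Any G-edge ab inside the common
-- neighbourhood of T would lie in H and be missed by z, so by termination that
-- common neighbourhood is a clique in the complement, contradicting interestingness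
-- of T.
module Submission where

open import Defs
open import Data.Nat using (ℕ)
open import Data.Fin using (Fin)
open import Function using (id)
open import Data.Product using (∃; _×_; _,_; proj₁; proj₂)
open import Data.Sum using (_⊎_; inj₁; inj₂)
open import Relation.Nullary using (¬_; yes; no; contradiction)
open import Relation.Unary using (_⊆_; _≐_)
open import Relation.Binary.PropositionalEquality using (_≢_; refl; subst)
  renaming (sym to ≡-sym)

private
  variable
    n : ℕ
    G G′ : Graph n
    S S′ X J T : VSet n
    u v w x y z : Fin n

Reach-end : Reach G S u w → S w
Reach-end (here s)     = s
Reach-end (step _ _ s) = s

Reach-trans : Reach G S u v → Reach G S v w → Reach G S u w
Reach-trans p (here _)     = p
Reach-trans p (step q a s) = step (Reach-trans p q) a s

Reach-sym : Reach G S u w → Reach G S w u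
Reach-sym (here s)     = here s
Reach-sym {G = G} (step p a s) =
  Reach-trans (step (here s) (Graph.sym G a) (Reach-end p)) (Reach-sym p)

Reach-map : (∀ {a b} → Adj G a b → Adj G′ a b) → S ⊆ S′ →
            Reach G S u w → Reach G′ S′ u w
Reach-map f g (here s)     = here (g s)
Reach-map f g (step p a s) = step (Reach-map f g p) (f a) (g s)

Reach⇒Reach-Comp : (p : Reach G (Minus X) v w) → Reach G (Comp G X v) v w
Reach⇒Reach-Comp (here s)     = here (here s)
Reach⇒Reach-Comp (step p a s) = step (Reach⇒Reach-Comp p) a (step p a s)

Comp-connected : ConnectedOn G (Comp G X v)
Comp-connected a b p q = Reach-trans (Reach-sym (Reach⇒Reach-Comp p)) (Reach⇒Reach-Comp q)

adj⇒compl²-adj : Adj G u w → Adj (compl (compl G)) u w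
adj⇒compl²-adj {G = G} {u = u} a =
  (λ u≡w → Graph.irrefl G (subst (Adj G u) (≡-sym u≡w) a)) , (λ c → proj₂ c a)

compl²-adj⇒adj : Adj (compl (compl G)) u w → Adj G u w
compl²-adj⇒adj {G = G} {u = u} {w = w} (u≢w , ¬c) with adj? G u w
... | yes a  = a
... | no ¬a  = contradiction (u≢w , ¬a) ¬c

Com-resp-≐ : S ≐ S′ → Com G S ⊆ Com G S′
Com-resp-≐ (S⊆S′ , S′⊆S) (∉S , adj) = (λ s′ → ∉S (S′⊆S s′)) , (λ u s′ → adj u (S′⊆S s′))

Interesting-resp-≐ : S ≐ S′ → Interesting G S → Interesting G S′
Interesting-resp-≐ {G = G} S≐S′@(S⊆S′ , S′⊆S) ((t , s) , connected , ¬clique) =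
  (t , S⊆S′ s) ,
  (λ a b p q → Reach-map id S⊆S′ (connected a b (S′⊆S p) (S′⊆S q))) ,
  (λ clique → ¬clique λ a b p q →
     clique a b (Com-resp-≐ {G = G} S≐S′ p) (Com-resp-≐ {G = G} S≐S′ q))

MaximalInteresting-resp-≐ : S ≐ S′ → MaximalInteresting G S → MaximalInteresting G S′
MaximalInteresting-resp-≐ S≐S′@(S⊆S′ , S′⊆S) (interesting , maximal) =
  Interesting-resp-≐ S≐S′ interesting ,
  λ T′ i S′⊆T′ t → S⊆S′ (maximal T′ i (λ s → S′⊆T′ (S⊆S′ s)) t)

-- Outside G J is the paper's V ∖ (J ∪ N(J)); HandleOf G v x y unfolds to
-- Outside G (CoHandleOf G v x y), and Terminal G v x y to LoopHalts G (HandleOf G v x y).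
Outside : Graph n → VSet n → VSet n
Outside G J w = ¬ (J w ⊎ Nbh G J w)

LoopHalts : Graph n → VSet n → Set
LoopHalts G H = ¬ (∃ λ v′ → ∃ λ x′ → ∃ λ y′ → LoopStep G H v′ x′ y′)

Com-compl-⊆-Outside : J ⊆ T → Com (compl G) T ⊆ Outside G J
Com-compl-⊆-Outside J⊆T (∉T , _)   (inj₁ j)              = ∉T (J⊆T j)
Com-compl-⊆-Outside J⊆T (_ , adjT) (inj₂ (_ , u , j , a)) = proj₂ (adjT u (J⊆T j)) a

LoopHalts⇒Com-clique : LoopHalts G (Outside G J) → J ⊆ T → T z →
                       Nbh G (Outside G J) z → CliqueOn (compl G) (Com (compl G) T)
LoopHalts⇒Com-clique {G = G} {z = z} halts J⊆T z∈T z∈NH a b a∈C b∈C a≢b =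
  a≢b , λ ab → halts (z , a , b , z∈NH , inH a∈C , inH b∈C , ab ,
                      proj₂ (proj₂ a∈C z z∈T) , proj₂ (proj₂ b∈C z z∈T))
  where inH = Com-compl-⊆-Outside {G = G} J⊆T

module ComponentOutsideNbh (G : Graph n) (X : VSet n) (v : Fin n)
                           (v∉X : ¬ X v) (v∉NX : ¬ Nbh G X v) where

  CoHandle : VSet n
  CoHandle = Comp G (Nbh G X) v

  CoHandle-disjoint : CoHandle w → ¬ X w
  CoHandle-disjoint (here _)             = v∉X
  CoHandle-disjoint {w = w} (step p a _) x∈X =
    Reach-end p (CoHandle-disjoint p , w , x∈X , Graph.sym G a)

  CoHandle-nonadjacent : CoHandle w → X u → ¬ Adj G u w
  CoHandle-nonadjacent {u = u} j u∈X a = Reach-end j (CoHandle-disjoint j , u , u∈X , a)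

  X⊆Outside : X ⊆ Outside G CoHandle
  X⊆Outside u∈X (inj₁ j)              = CoHandle-disjoint j u∈X
  X⊆Outside u∈X (inj₂ (_ , _ , j , a)) = CoHandle-nonadjacent j u∈X (Graph.sym G a)

  X⊆Com-compl : X ⊆ Com (compl G) CoHandle
  X⊆Com-compl {u} u∈X =
    (λ j → CoHandle-disjoint j u∈X) ,
    λ w j → (λ w≡u → CoHandle-disjoint j (subst X (≡-sym w≡u) u∈X)) ,
            (λ a → CoHandle-nonadjacent j u∈X (Graph.sym G a))

  CoHandle-interesting : X x → X y → Adj G x y → Interesting (compl G) CoHandle
  CoHandle-interesting {x} {y} x∈X y∈X xy =
    (v , here v∉NX) ,
    (λ a b p q → Reach-map (adj⇒compl²-adj {G = G}) id (Comp-connected a b p q)) ,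
    (λ clique → proj₂ (clique x y (X⊆Com-compl x∈X) (X⊆Com-compl y∈X) x≢y) xy)
    where
    x≢y : x ≢ y
    x≢y x≡y = Graph.irrefl G (subst (Adj G x) (≡-sym x≡y) xy)

  CoHandle-maximal : LoopHalts G (Outside G CoHandle) → (T : VSet n) →
                     Interesting (compl G) T → CoHandle ⊆ T → T ⊆ CoHandle
  CoHandle-maximal halts T (_ , connected , ¬clique) J⊆T {t} t∈T =
    stays (Reach-map (compl²-adj⇒adj {G = G}) id
                     (connected v t (J⊆T (here v∉NX)) t∈T))
    where
    stays : Reach G T v w → CoHandle w
    stays (here _)                 = here v∉NX
    stays {w = z} (step {w} p a z∈T) = step j a z∉NX
      where
      j : CoHandle w
      j = stays p
      z∉NX : ¬ Nbh G X z
      z∉NX z∈NX@(_ , u , u∈X , uz) =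
        ¬clique (LoopHalts⇒Com-clique {G = G} halts J⊆T z∈T z∈NH)
        where
        z∈NH : Nbh G (Outside G CoHandle) z
        z∈NH = (λ z∉J∪NJ → z∉J∪NJ (inj₂ ((λ jz → Reach-end jz z∈NX) , w , j , a))) ,
               u , X⊆Outside u∈X , uz

  CoHandle-maximalInteresting : X x → X y → Adj G x y →
    LoopHalts G (Outside G CoHandle) → MaximalInteresting (compl G) CoHandle
  CoHandle-maximalInteresting x∈X y∈X xy halts =
    CoHandle-interesting x∈X y∈X xy , λ _ → CoHandle-maximal halts _

reachable⇒misses-edge : Reachable G v x y → Adj G x y × Misses G v x y
reachable⇒misses-edge (start xy m)                  = xy , m
reachable⇒misses-edge (next _ (_ , _ , _ , xy , m)) = xy , m

misses⇒∉pair : Adj G x y → Misses G v x y → ¬ pair x y v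
misses⇒∉pair xy (_ , ¬vy) (inj₁ refl) = ¬vy xy
misses⇒∉pair {G = G} xy (¬vx , _) (inj₂ refl) = ¬vx (Graph.sym G xy)

misses⇒∉NbhE : Misses G v x y → ¬ NbhE G x y v
misses⇒∉NbhE {G = G} (¬vx , _) (_ , _ , inj₁ refl , a) = ¬vx (Graph.sym G a)
misses⇒∉NbhE {G = G} (_ , ¬vy) (_ , _ , inj₂ refl , a) = ¬vy (Graph.sym G a)

lemma17 : (n : ℕ) (G : Graph n) (H J : VSet n) →
    Returns G H J → MaximalInteresting (compl G) J
lemma17 n G H J (v , x , y , run , halts , _ , J≐CoHandle) =
  MaximalInteresting-resp-≐ CoHandle≐J
    (C.CoHandle-maximalInteresting (inj₁ refl) (inj₂ refl) xy halts)
  where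
  xy : Adj G x y
  xy = proj₁ (reachable⇒misses-edge run)
  misses : Misses G v x y
  misses = proj₂ (reachable⇒misses-edge run)
  module C = ComponentOutsideNbh G (pair x y) v
               (misses⇒∉pair {G = G} xy misses) (misses⇒∉NbhE {G = G} misses)
  CoHandle≐J : C.CoHandle ≐ J
  CoHandle≐J = (λ {w} → proj₂ (J≐CoHandle w)) , (λ {w} → proj₁ (J≐CoHandle w))
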